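{- Let $G$ be a graph, let $\ell\geq 1$, and let $B\subseteq V(G)$. Then $B$ is a mixed $\ell$-leaky forcing set of $G$ if and only if $B$ is an $(\ell-1)$-leaky forcing set of $G$ such that for every set $L$ of $\ell-1$ vertex leaks and every $v\in V(G)\setminus B$, there exist forces $x\rightarrow v,\ y\rightarrow v\in \mathcal{F}_L(B)$ with $y\neq x$.
   Context: All graphs are finite simple graphs. Given a graph $G$ and a set $B\subseteq V(G)$ of initially blue vertices (all other vertices white), the zero forcing color-change rule says: if a blue vertex $u$ has exactly one white neighbor $w$, then $u$ may force $w$ (written $u\rightarrow w$, a force). A vertex leak is a vertex not allowed to perform any force. A set $B$ is an $\ell$-leaky forcing set if for every set $L$ of $\ell$ vertex leaks, exhaustively applying the color-change rule from $B$ (with vertices of $L$ never forcing) turns all of $G$ blue. For a set $L$ of vertex leaks, a forcing process of $B$ with leaks $L$ is a set of forces, none performed by a vertex of $L$, admitting a chronological ordering in which every force is valid when performed and at the end all of $G$ is blue; $\mathcal{F}_L(B)$ is the set of forces belonging to some such forcing process. An edge leak is an edge $xy$ across which no force may be performed (neither $x\rightarrow y$ nor $y\rightarrow x$). A specified leak $x\rightarrow y$ (for adjacent $x,y$) prohibits the single force of $x$ forcing $y$. These are collectively called leaks. A set $B$ is a mixed $\ell$-leaky forcing set of $G$ if $B$ can color all of $G$ blue despite any set of $\ell$ leaks (each being a vertex leak, edge leak or specified leak). -}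

module Defs where

open import Data.Nat using (ℕ; _≤_; _∸_)
open import Data.Bool using (Bool; true; false)
open import Data.Fin using (Fin)
open import Data.Fin.Subset using (Subset; _∈_; _∉_; ⁅_⁆; _∪_; ∣_∣)
open import Data.List using (List; []; _∷_; length)
open import Data.List.Relation.Unary.Any using (Any)
open import Data.List.Membership.Propositional using () renaming (_∈_ to _∈ˡ_)
open import Data.Product using (_×_; _,_; proj₂; ∃-syntax)
open import Data.Sum using (_⊎_)
open import Relation.Binary.PropositionalEquality using (_≡_; _≢_)
open import Relation.Nullary using (¬_)

record Graph (n : ℕ) : Set where
  field
    adj    : Fin n → Fin n → Bool
    sym    : ∀ x y → adj x y ≡ adj y x
    irrefl : ∀ x → adj x x ≡ false

open Graph public

Edge : ∀ {n} → Graph n → Fin n → Fin n → Set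
Edge G x y = adj G x y ≡ true

Force : ℕ → Set
Force n = Fin n × Fin n

CanForce : ∀ {n} → Graph n → Subset n → Fin n → Fin n → Set
CanForce G S u w =
  u ∈ S × w ∉ S × Edge G u w × (∀ z → Edge G u z → z ∉ S → z ≡ w)

data ValidSeq {n} (G : Graph n) (allowed : Fin n → Fin n → Set)
     : Subset n → List (Force n) → Set where
  []  : ∀ {S} → ValidSeq G allowed S []
  _∷_ : ∀ {S u w fs} → CanForce G S u w × allowed u w →
        ValidSeq G allowed (S ∪ ⁅ w ⁆) fs →
        ValidSeq G allowed S ((u , w) ∷ fs)

IsForcingProcess : ∀ {n} → Graph n → (Fin n → Fin n → Set) →
                   Subset n → List (Force n) → Set
IsForcingProcess G allowed B fs =
  ValidSeq G allowed B fs × (∀ v → v ∈ B ⊎ Any (λ f → proj₂ f ≡ v) fs)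

VertexLeakAllowed : ∀ {n} → Subset n → Fin n → Fin n → Set
VertexLeakAllowed L u w = u ∉ L

InForcesL : ∀ {n} → Graph n → Subset n → Subset n → Force n → Set
InForcesL G L B f =
  ∃[ fs ] (IsForcingProcess G (VertexLeakAllowed L) B fs × f ∈ˡ fs)

IsLeakyForcingSet : ∀ {n} → Graph n → ℕ → Subset n → Set
IsLeakyForcingSet G ℓ B =
  ∀ (L : Subset _) → ∣ L ∣ ≤ ℓ →
  ∃[ fs ] IsForcingProcess G (VertexLeakAllowed L) B fs

data Leak {n} (G : Graph n) : Set where
  vertexLeak : Fin n → Leak G
  edgeLeak   : (x y : Fin n) → Edge G x y → Leak G
  specLeak   : (x y : Fin n) → Edge G x y → Leak G

Forbids : ∀ {n} {G : Graph n} → Leak G → Fin n → Fin n → Set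
Forbids (vertexLeak v)   u w = u ≡ v
Forbids (edgeLeak x y _) u w = (u ≡ x × w ≡ y) ⊎ (u ≡ y × w ≡ x)
Forbids (specLeak x y _) u w = u ≡ x × w ≡ y

MixedAllowed : ∀ {n} {G : Graph n} → List (Leak G) → Fin n → Fin n → Set
MixedAllowed Ls u w = ¬ Any (λ lk → Forbids lk u w) Ls

IsMixedLeakyForcingSet : ∀ {n} → Graph n → ℕ → Subset n → Set
IsMixedLeakyForcingSet G ℓ B =
  ∀ (Ls : List (Leak G)) → length Ls ≤ ℓ →
  ∃[ fs ] IsForcingProcess G (MixedAllowed Ls) B fs

module Submission where

-- Necessity: a forcing process despite the vertex leaks L exists, and if x → v is a force of
-- it, then a process despite L together with the specified leak x → v forces v from some
-- y ≠ x.
--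
-- Sufficiency: given ℓ mixed leaks, run the color-change rule greedily until it stalls at a
-- blue set C ⊇ B, and suppose C ≠ V(G).  Keep the first leak and replace each other leak by
-- the vertex it would stop from forcing out of C; this yields a set L of at most ℓ − 1
-- vertex leaks.  Every forcing process of B despite L leaves C through a force that is
-- valid for the blue set C; such a force is not blocked by the replaced leaks, so (C being
-- stalled) it is blocked by the first leak.  A single leak blocks at most one force valid
-- for C, so all these processes leave C through the same force a → b, and as a vertex is
-- forced only once in a process, a is the only forcer of b in 𝓕_L(B).

open import Defs hiding (sym)
open import Data.Nat using (ℕ; suc; _+_; _≤_; _<_; _∸_; z≤n; s≤s)
open import Data.Nat.Properties
  using (≤-trans; ≤-reflexive; ≤-antisym; +-suc; +-identityʳ; +-monoˡ-≤; m≤n⇒m≤1+n; m≤n+m)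
open import Data.Bool using (if_then_else_)
open import Data.Bool.Properties using () renaming (_≟_ to _≟ᵇ_)
open import Data.Fin using (Fin; zero; suc; _≟_)
open import Data.Fin.Properties using (any?; all?)
open import Data.Fin.Subset using (Subset; _∈_; _∉_; _⊆_; _∪_; ⁅_⁆; ⊥; ∣_∣; inside; outside)
open import Data.Fin.Subset.Properties
  using (_∈?_; x∈p∪q⁻; x∈p∪q⁺; x∈⁅x⁆; x∈⁅y⁆⇒x≡y; p⊆p∪q; ∈⊤; ∣p∣≤n; ∣p∣≡n⇒p≡⊤; ∣⊥∣≡0; ∣⁅x⁆∣≡1; p⊂q⇒∣p∣<∣q∣)
open import Data.Vec using ([]; _∷_; here; there)
open import Data.List using (List; []; _∷_; length; map; _++_)
open import Data.List.Properties using (length-map; length-++)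
open import Data.List.Relation.Unary.Any as Any using (Any; here; there)
open import Data.List.Relation.Unary.Any.Properties using (map⁺; ++⁺ʳ)
open import Data.List.Membership.Propositional using (find) renaming (_∈_ to _∈ˡ_)
open import Data.Product using (_×_; _,_; ∃-syntax; proj₁; proj₂)
open import Data.Sum using (_⊎_; inj₁; inj₂)
open import Data.Empty using () renaming (⊥ to Empty; ⊥-elim to ⊥-elim)
open import Function using (_∘_)
open import Function.Bundles using (_⇔_; mk⇔)
open import Relation.Binary.PropositionalEquality using (_≡_; _≢_; refl; sym; trans; cong; subst)
open import Relation.Nullary using (¬_; Dec; yes; no; does)
open import Relation.Nullary.Decidable using (_×-dec_; _⊎-dec_; _→-dec_; ¬?; decidable-stable)

∣p∪q∣≤∣p∣+∣q∣ : ∀ {n} (p q : Subset n) → ∣ p ∪ q ∣ ≤ ∣ p ∣ + ∣ q ∣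
∣p∪q∣≤∣p∣+∣q∣ []            []            = z≤n
∣p∪q∣≤∣p∣+∣q∣ (inside  ∷ p) (inside  ∷ q) =
  s≤s (≤-trans (m≤n⇒m≤1+n (∣p∪q∣≤∣p∣+∣q∣ p q)) (≤-reflexive (sym (+-suc ∣ p ∣ ∣ q ∣))))
∣p∪q∣≤∣p∣+∣q∣ (inside  ∷ p) (outside ∷ q) = s≤s (∣p∪q∣≤∣p∣+∣q∣ p q)
∣p∪q∣≤∣p∣+∣q∣ (outside ∷ p) (inside  ∷ q) =
  ≤-trans (s≤s (∣p∪q∣≤∣p∣+∣q∣ p q)) (≤-reflexive (sym (+-suc ∣ p ∣ ∣ q ∣)))
∣p∪q∣≤∣p∣+∣q∣ (outside ∷ p) (outside ∷ q) = ∣p∪q∣≤∣p∣+∣q∣ p q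

x∉p⇒∣p∣<∣p∪⁅x⁆∣ : ∀ {n} {p : Subset n} {x} → x ∉ p → ∣ p ∣ < ∣ p ∪ ⁅ x ⁆ ∣
x∉p⇒∣p∣<∣p∪⁅x⁆∣ {x = x} x∉p = p⊂q⇒∣p∣<∣q∣ (p⊆p∪q ⁅ x ⁆ , x , x∈p∪q⁺ (inj₂ (x∈⁅x⁆ x)) , x∉p)

n≤∣p∣⇒x∈p : ∀ {n} {p : Subset n} → n ≤ ∣ p ∣ → ∀ x → x ∈ p
n≤∣p∣⇒x∈p {p = p} n≤∣p∣ x = subst (x ∈_) (sym (∣p∣≡n⇒p≡⊤ (≤-antisym (∣p∣≤n p) n≤∣p∣))) ∈⊤

p⊆q⇒x∈q⇒p∪⁅x⁆⊆q : ∀ {n} {p q : Subset n} {x} → p ⊆ q → x ∈ q → p ∪ ⁅ x ⁆ ⊆ q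
p⊆q⇒x∈q⇒p∪⁅x⁆⊆q {p = p} {q} {x} p⊆q x∈q y∈ with x∈p∪q⁻ p ⁅ x ⁆ y∈
... | inj₁ y∈p = p⊆q y∈p
... | inj₂ y∈⁅x⁆ = subst (_∈ q) (sym (x∈⁅y⁆⇒x≡y x y∈⁅x⁆)) x∈q

elements : ∀ {n} → Subset n → List (Fin n)
elements []            = []
elements (inside  ∷ p) = zero ∷ map suc (elements p)
elements (outside ∷ p) = map suc (elements p)

length-elements : ∀ {n} (p : Subset n) → length (elements p) ≡ ∣ p ∣
length-elements []            = refl
length-elements (inside  ∷ p) = cong suc (trans (length-map suc (elements p)) (length-elements p))
length-elements (outside ∷ p) = trans (length-map suc (elements p)) (length-elements p)

∈⇒∈elements : ∀ {n} {p : Subset n} {x} → x ∈ p → x ∈ˡ elements p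
∈⇒∈elements {p = inside  ∷ p} here      = here refl
∈⇒∈elements {p = inside  ∷ p} (there m) = there (map⁺ (Any.map (cong suc) (∈⇒∈elements m)))
∈⇒∈elements {p = outside ∷ p} (there m) = map⁺ (Any.map (cong suc) (∈⇒∈elements m))

Stalled : ∀ {n} → Graph n → (Fin n → Fin n → Set) → Subset n → Set
Stalled G allowed C = ∀ a b → CanForce G C a b → ¬ allowed a b

module _ {n} (G : Graph n) where

  ValidSeq-mono : ∀ {A A′ : Fin n → Fin n → Set} → (∀ {u w} → A u w → A′ u w) →
                  ∀ {S fs} → ValidSeq G A S fs → ValidSeq G A′ S fs
  ValidSeq-mono A⇒A′ []                    = []
  ValidSeq-mono A⇒A′ ((uw , allowed) ∷ vs) = (uw , A⇒A′ allowed) ∷ ValidSeq-mono A⇒A′ vs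

  ∈⇒edge×allowed : ∀ {A S fs u w} → ValidSeq G A S fs → (u , w) ∈ˡ fs → Edge G u w × A u w
  ∈⇒edge×allowed (((_ , _ , uw , _) , allowed) ∷ _) (here refl) = uw , allowed
  ∈⇒edge×allowed (_ ∷ vs) (there m) = ∈⇒edge×allowed vs m

  ∈⇒target∉start : ∀ {A S fs u w} → ValidSeq G A S fs → (u , w) ∈ˡ fs → w ∉ S
  ∈⇒target∉start (((_ , w∉S , _) , _) ∷ _) (here refl) = w∉S
  ∈⇒target∉start (_ ∷ vs) (there m) = ∈⇒target∉start vs m ∘ p⊆p∪q _

  forcer-unique : ∀ {A S fs x y v} → ValidSeq G A S fs → (x , v) ∈ˡ fs → (y , v) ∈ˡ fs → x ≡ y
  forcer-unique _        (here refl) (here refl) = refl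
  forcer-unique (_ ∷ vs) (here refl) (there m)   = ⊥-elim (∈⇒target∉start vs m (x∈p∪q⁺ (inj₂ (x∈⁅x⁆ _))))
  forcer-unique (_ ∷ vs) (there m)   (here refl) = ⊥-elim (∈⇒target∉start vs m (x∈p∪q⁺ (inj₂ (x∈⁅x⁆ _))))
  forcer-unique (_ ∷ vs) (there m)   (there m′)  = forcer-unique vs m m′

  process-forcer : ∀ {A B fs v} → IsForcingProcess G A B fs → v ∉ B → ∃[ x ] (x , v) ∈ˡ fs
  process-forcer {v = v} (_ , covers) v∉B with covers v
  ... | inj₁ v∈B = ⊥-elim (v∉B v∈B)
  ... | inj₂ forced with find forced
  ...   | (x , _) , xv∈fs , refl = x , xv∈fs

  exit-force : ∀ {A S C fs x v} → ValidSeq G A S fs → S ⊆ C → (x , v) ∈ˡ fs → v ∉ C →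
               ∃[ a ] ∃[ b ] ((a , b) ∈ˡ fs × CanForce G C a b × A a b)
  exit-force {C = C} (_∷_ {u = u} {w} ((u∈S , _ , uw , unique) , allowed) vs) S⊆C xv∈ v∉C
    with w ∈? C
  ... | no w∉C = u , w , here refl , (S⊆C u∈S , w∉C , uw , λ z uz z∉C → unique z uz (z∉C ∘ S⊆C)) , allowed
  ... | yes w∈C with xv∈
  ...   | here refl = ⊥-elim (v∉C w∈C)
  ...   | there xv∈fs =
    let (a , b , ab∈fs , ab) = exit-force vs (p⊆q⇒x∈q⇒p∪⁅x⁆⊆q S⊆C w∈C) xv∈fs v∉C
    in a , b , there ab∈fs , ab

  canForce? : ∀ S u w → Dec (CanForce G S u w)
  canForce? S u w =
    (u ∈? S) ×-dec ¬? (w ∈? S) ×-dec (adj G u w ≟ᵇ _) ×-dec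
    all? (λ z → (adj G u z ≟ᵇ _) →-dec ¬? (z ∈? S) →-dec (z ≟ w))

  record Closure (A : Fin n → Fin n → Set) (S : Subset n) : Set where
    field
      blue       : Subset n
      forces     : List (Force n)
      valid      : ValidSeq G A S forces
      start⊆blue : S ⊆ blue
      covered    : ∀ v → v ∈ blue → v ∈ S ⊎ Any (λ f → proj₂ f ≡ v) forces
      stalled    : Stalled G A blue

  closure-∷ : ∀ {A S u w} → CanForce G S u w → A u w → Closure A (S ∪ ⁅ w ⁆) → Closure A S
  closure-∷ {A} {S} {u} {w} uw allowed cl = record
    { blue = blue ; forces = (u , w) ∷ forces ; valid = (uw , allowed) ∷ valid
    ; start⊆blue = start⊆blue ∘ p⊆p∪q _ ; covered = covered′ ; stalled = stalled }
    where
    open Closure cl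
    covered′ : ∀ v → v ∈ blue → v ∈ S ⊎ Any (λ f → proj₂ f ≡ v) ((u , w) ∷ forces)
    covered′ v v∈ with covered v v∈
    ... | inj₂ forced = inj₂ (there forced)
    ... | inj₁ v∈S∪w with x∈p∪q⁻ S ⁅ w ⁆ v∈S∪w
    ...   | inj₁ v∈S = inj₁ v∈S
    ...   | inj₂ v∈⁅w⁆ = inj₂ (here (sym (x∈⁅y⁆⇒x≡y w v∈⁅w⁆)))

  module _ {A : Fin n → Fin n → Set} (A? : ∀ u w → Dec (A u w)) where

    -- k bounds the number of white vertices, hence the number of forces still possible.
    closure-within : ∀ k S → n ≤ ∣ S ∣ + k → Closure A S
    closure-within k S bound with any? (λ u → any? (λ w → canForce? S u w ×-dec A? u w))
    ... | no none = record
      { blue = S ; forces = [] ; valid = [] ; start⊆blue = λ v∈ → v∈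
      ; covered = λ _ → inj₁ ; stalled = λ a b ab allowed → none (a , b , ab , allowed) }
    closure-within 0 S bound | yes (_ , w , (_ , w∉S , _) , _) =
      ⊥-elim (w∉S (n≤∣p∣⇒x∈p (subst (n ≤_) (+-identityʳ _) bound) w))
    closure-within (suc k) S bound | yes (_ , w , uw , allowed) =
      closure-∷ uw allowed (closure-within k (S ∪ ⁅ w ⁆) bound′)
      where
      bound′ : n ≤ ∣ S ∪ ⁅ w ⁆ ∣ + k
      bound′ = ≤-trans bound (≤-trans (≤-reflexive (+-suc ∣ S ∣ k))
                                      (+-monoˡ-≤ k (x∉p⇒∣p∣<∣p∪⁅x⁆∣ (proj₁ (proj₂ uw)))))

    closure : ∀ S → Closure A S
    closure S = closure-within n S (m≤n+m n ∣ S ∣)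

module _ {n} {G : Graph n} where

  forbids? : (lk : Leak G) → ∀ u w → Dec (Forbids lk u w)
  forbids? (vertexLeak v)   u w = u ≟ v
  forbids? (edgeLeak x y _) u w = ((u ≟ x) ×-dec (w ≟ y)) ⊎-dec ((u ≟ y) ×-dec (w ≟ x))
  forbids? (specLeak x y _) u w = (u ≟ x) ×-dec (w ≟ y)

  mixedAllowed? : (Ls : List (Leak G)) → ∀ u w → Dec (MixedAllowed Ls u w)
  mixedAllowed? Ls u w = ¬? (Any.any? (λ lk → forbids? lk u w) Ls)

  stalled⇒forbidden : ∀ {Ls C a b} → Stalled G (MixedAllowed Ls) C → CanForce G C a b →
                      Any (λ lk → Forbids lk a b) Ls
  stalled⇒forbidden {Ls} {a = a} {b} stall ab =
    decidable-stable (Any.any? (λ lk → forbids? lk a b) Ls) (stall a b ab)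

  vertexLeaks : Subset n → List (Leak G)
  vertexLeaks L = map vertexLeak (elements L)

  length-vertexLeaks : ∀ L → length (vertexLeaks L) ≡ ∣ L ∣
  length-vertexLeaks L = trans (length-map vertexLeak (elements L)) (length-elements L)

  mixedAllowed⇒vertexLeakAllowed : ∀ (extra : List (Leak G)) L {u w} → MixedAllowed (extra ++ vertexLeaks L) u w →
                                   VertexLeakAllowed L u w
  mixedAllowed⇒vertexLeakAllowed extra L allowed u∈L =
    allowed (++⁺ʳ extra (map⁺ (∈⇒∈elements u∈L)))

  -- A force leaving C is only blocked by an edge leak in the direction away from C.
  blockedVertex : Subset n → Leak G → Fin n
  blockedVertex C (vertexLeak v)   = v
  blockedVertex C (edgeLeak x y _) = if does (x ∈? C) then x else y
  blockedVertex C (specLeak x _ _) = x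

  forbids⇒blockedVertex : ∀ C lk {a b} → Forbids lk a b → a ∈ C → b ∉ C → a ≡ blockedVertex C lk
  forbids⇒blockedVertex C (vertexLeak v) a≡v _ _ = a≡v
  forbids⇒blockedVertex C (edgeLeak x y _) forbids a∈C b∉C with x ∈? C | forbids
  ... | yes _   | inj₁ (a≡x , _)    = a≡x
  ... | yes x∈C | inj₂ (_ , refl)   = ⊥-elim (b∉C x∈C)
  ... | no x∉C  | inj₁ (refl , _)   = ⊥-elim (x∉C a∈C)
  ... | no _    | inj₂ (a≡y , _)    = a≡y
  forbids⇒blockedVertex C (specLeak x y _) (a≡x , _) _ _ = a≡x

  blockedVertices : Subset n → List (Leak G) → Subset n
  blockedVertices C []         = ⊥
  blockedVertices C (lk ∷ Ls) = ⁅ blockedVertex C lk ⁆ ∪ blockedVertices C Ls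

  ∣blockedVertices∣≤length : ∀ C Ls → ∣ blockedVertices C Ls ∣ ≤ length Ls
  ∣blockedVertices∣≤length C []         = ≤-reflexive (∣⊥∣≡0 n)
  ∣blockedVertices∣≤length C (lk ∷ Ls) =
    ≤-trans (∣p∪q∣≤∣p∣+∣q∣ ⁅ blockedVertex C lk ⁆ (blockedVertices C Ls))
            (subst (_≤ suc (length Ls)) (cong (_+ _) (sym (∣⁅x⁆∣≡1 (blockedVertex C lk))))
                   (s≤s (∣blockedVertices∣≤length C Ls)))

  forbidden⇒∈blockedVertices : ∀ C Ls {a b} → Any (λ lk → Forbids lk a b) Ls → a ∈ C → b ∉ C →
                                a ∈ blockedVertices C Ls
  forbidden⇒∈blockedVertices C (lk ∷ Ls) (here forbids) a∈C b∉C =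
    x∈p∪q⁺ (inj₁ (subst (_∈ ⁅ blockedVertex C lk ⁆)
                         (sym (forbids⇒blockedVertex C lk forbids a∈C b∉C)) (x∈⁅x⁆ _)))
  forbidden⇒∈blockedVertices C (lk ∷ Ls) (there forbidden) a∈C b∉C =
    x∈p∪q⁺ (inj₂ (forbidden⇒∈blockedVertices C Ls forbidden a∈C b∉C))

  stalled-∷⇒forbids-head : ∀ {lk Ls C a b} → Stalled G (MixedAllowed (lk ∷ Ls)) C →
                           CanForce G C a b → a ∉ blockedVertices C Ls → Forbids lk a b
  stalled-∷⇒forbids-head {Ls = Ls} {C} stall ab@(a∈C , b∉C , _) a∉L with stalled⇒forbidden stall ab
  ... | here forbids     = forbids
  ... | there forbidden = ⊥-elim (a∉L (forbidden⇒∈blockedVertices C Ls forbidden a∈C b∉C))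

  forbids-unique : ∀ {C} (lk : Leak G) {a b a′ b′} → Forbids lk a b → CanForce G C a b →
                   Forbids lk a′ b′ → CanForce G C a′ b′ → a ≡ a′ × b ≡ b′
  forbids-unique (vertexLeak v) refl (_ , _ , _ , unique) refl (_ , b′∉C , ab′ , _) =
    refl , sym (unique _ ab′ b′∉C)
  forbids-unique (edgeLeak x y _) (inj₁ (refl , refl)) _ (inj₁ (refl , refl)) _ = refl , refl
  forbids-unique (edgeLeak x y _) (inj₁ (refl , refl)) (_ , y∉C , _) (inj₂ (refl , refl)) (y∈C , _) =
    ⊥-elim (y∉C y∈C)
  forbids-unique (edgeLeak x y _) (inj₂ (refl , refl)) (y∈C , _) (inj₁ (refl , refl)) (_ , y∉C , _) =
    ⊥-elim (y∉C y∈C)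
  forbids-unique (edgeLeak x y _) (inj₂ (refl , refl)) _ (inj₂ (refl , refl)) _ = refl , refl
  forbids-unique (specLeak x y _) (refl , refl) _ (refl , refl) _ = refl , refl

HasTwoForcers : ∀ {n} → Graph n → ℕ → Subset n → Set
HasTwoForcers {n} G k B =
  ∀ (L : Subset n) → ∣ L ∣ ≤ k → ∀ (v : Fin n) → v ∉ B →
  ∃[ x ] ∃[ y ] (y ≢ x × InForcesL G L B (x , v) × InForcesL G L B (y , v))

module _ {n} {G : Graph n} {m B} (mixed : IsMixedLeakyForcingSet G (suc m) B) where

  process-despite : ∀ (extra : List (Leak G)) L → length extra + ∣ L ∣ ≤ suc m →
                    ∃[ fs ] IsForcingProcess G (MixedAllowed (extra ++ vertexLeaks L)) B fs
  process-despite extra L bound =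
    mixed (extra ++ vertexLeaks L)
          (subst (_≤ suc m) (sym (trans (length-++ extra) (cong (length extra +_) (length-vertexLeaks L))))
                 bound)

  restrict : ∀ (extra : List (Leak G)) L {fs} → IsForcingProcess G (MixedAllowed (extra ++ vertexLeaks L)) B fs →
             IsForcingProcess G (VertexLeakAllowed L) B fs
  restrict extra L (valid , covers) = ValidSeq-mono G (mixedAllowed⇒vertexLeakAllowed extra L) valid , covers

  mixed⇒leaky : IsLeakyForcingSet G m B
  mixed⇒leaky L ∣L∣≤m =
    let (fs , process) = process-despite [] L (m≤n⇒m≤1+n ∣L∣≤m) in fs , restrict [] L process

  mixed⇒twoForcers : HasTwoForcers G m B
  mixed⇒twoForcers L ∣L∣≤m v v∉B =
    let (fs₁ , process₁) = process-despite [] L (m≤n⇒m≤1+n ∣L∣≤m)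
        (x , xv∈fs₁)     = process-forcer G process₁ v∉B
        xv               = proj₁ (∈⇒edge×allowed G (proj₁ process₁) xv∈fs₁)
        x↛v              = specLeak x v xv ∷ []
        (fs₂ , process₂) = process-despite x↛v L (s≤s ∣L∣≤m)
        (y , yv∈fs₂)     = process-forcer G process₂ v∉B
        y→v-allowed      = proj₂ (∈⇒edge×allowed G (proj₁ process₂) yv∈fs₂)
    in x , y , (λ y≡x → y→v-allowed (here (y≡x , refl))) ,
       (fs₁ , restrict [] L process₁ , xv∈fs₁) , (fs₂ , restrict x↛v L process₂ , yv∈fs₂)

module _ {n} {G : Graph n} {B : Subset n} where

  sole-forcer : ∀ {C} → B ⊆ C → ∀ L (lk : Leak G) →
                (∀ {a′ b′} → CanForce G C a′ b′ → a′ ∉ L → Forbids lk a′ b′) →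
                ∀ {a b x} → CanForce G C a b → a ∉ L → InForcesL G L B (x , b) → x ≡ a
  sole-forcer B⊆C L lk forbidden ab a∉L (fs , (valid , _) , xb∈fs)
    with exit-force G valid B⊆C xb∈fs (proj₁ (proj₂ ab))
  ... | _ , _ , a′b′∈fs , a′b′ , a′∉L
    with forbids-unique lk (forbidden ab a∉L) ab (forbidden a′b′ a′∉L) a′b′
  ... | refl , refl = forcer-unique G valid xb∈fs a′b′∈fs

module _ {n} {G : Graph n} {m B} (leaky : IsLeakyForcingSet G m B) (twoForcers : HasTwoForcers G m B) where

  exit-despite : ∀ {C v} → B ⊆ C → v ∉ C → ∀ L → ∣ L ∣ ≤ m → ∃[ a ] ∃[ b ] (CanForce G C a b × a ∉ L)
  exit-despite B⊆C v∉C L ∣L∣≤m =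
    let (fs , process)         = leaky L ∣L∣≤m
        (_ , xv∈fs)            = process-forcer G process (v∉C ∘ B⊆C)
        (a , b , _ , ab , a∉L) = exit-force G (proj₁ process) B⊆C xv∈fs v∉C
    in a , b , ab , a∉L

  one-leak-cannot-confine : ∀ {C v} → B ⊆ C → v ∉ C → ∀ L (lk : Leak G) → ∣ L ∣ ≤ m →
                            (∀ {a b} → CanForce G C a b → a ∉ L → Forbids lk a b) → Empty
  one-leak-cannot-confine B⊆C v∉C L lk ∣L∣≤m forbidden with exit-despite B⊆C v∉C L ∣L∣≤m
  ... | a , b , ab@(_ , b∉C , _) , a∉L with twoForcers L ∣L∣≤m b (b∉C ∘ B⊆C)
  ... | x , y , y≢x , xb , yb = y≢x (trans (sole yb) (sym (sole xb)))
    where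
    sole : ∀ {z} → InForcesL G L B (z , b) → z ≡ a
    sole = sole-forcer B⊆C L lk forbidden ab a∉L

  stalled⇒covers : ∀ (Ls : List (Leak G)) → length Ls ≤ suc m → ∀ {C} → B ⊆ C → Stalled G (MixedAllowed Ls) C → ∀ v → v ∈ C
  stalled⇒covers Ls ∣Ls∣≤1+m {C} B⊆C stall v = decidable-stable (v ∈? C) (escape Ls ∣Ls∣≤1+m stall)
    where
    escape : ∀ (Ls : List (Leak G)) → length Ls ≤ suc m → Stalled G (MixedAllowed Ls) C → v ∉ C → Empty
    escape [] _ stall v∉C =
      let (a , b , ab , _) = exit-despite B⊆C v∉C ⊥ (subst (_≤ m) (sym (∣⊥∣≡0 n)) z≤n)
      in stall a b ab (λ ())
    escape (lk ∷ Ls) (s≤s ∣Ls∣≤m) stall v∉C =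
      one-leak-cannot-confine B⊆C v∉C (blockedVertices C Ls) lk
        (≤-trans (∣blockedVertices∣≤length C Ls) ∣Ls∣≤m) (stalled-∷⇒forbids-head stall)

  leaky∧twoForcers⇒mixed : IsMixedLeakyForcingSet G (suc m) B
  leaky∧twoForcers⇒mixed Ls ∣Ls∣≤1+m = forces , valid , λ v → covered v (all-blue v)
    where
    open Closure (closure G (mixedAllowed? Ls) B)
    all-blue : ∀ v → v ∈ blue
    all-blue = stalled⇒covers Ls ∣Ls∣≤1+m start⊆blue stalled

theorem4p2 : ∀ {n} (G : Graph n) (ℓ : ℕ) → 1 ≤ ℓ → (B : Subset n) →
    IsMixedLeakyForcingSet G ℓ B ⇔
    (IsLeakyForcingSet G (ℓ ∸ 1) B ×
    (∀ (L : Subset n) → ∣ L ∣ ≤ ℓ ∸ 1 → ∀ (v : Fin n) → v ∉ B →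
    ∃[ x ] ∃[ y ] (y ≢ x × InForcesL G L B (x , v) × InForcesL G L B (y , v))))
theorem4p2 G (suc m) (s≤s z≤n) B =
  mk⇔ (λ mixed → mixed⇒leaky mixed , mixed⇒twoForcers mixed)
      (λ (leaky , twoForcers) → leaky∧twoForcers⇒mixed leaky twoForcers)
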